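{- Let $q$ be a power of an odd prime and $m,d$ positive integers with $q-1=md$. Let $u,v\in\mathbb{F}_q^{\ast}$ be two distinct elements, both of multiplicative order $m$, and set $a=(u-v)/d\in\mathbb{F}_q$. Then the polynomial $f(x)=a\sum_{i=0}^{d-1}x^{im+1}+vx$ is a permutation polynomial of $\mathbb{F}_q$, and the permutation it induces has cycle type $1+m^d$.
   Context: The order of a nonzero element means its order in $\mathbb{F}_q^{\ast}$. Cycle type $1+m^d$ means exactly one fixed point and $d$ further disjoint cycles each of length $m$. -}

module Defs where

open import Level using (0ℓ)
open import Algebra.Bundles using (CommutativeRing)
open import Data.Nat using (ℕ; zero; suc; _<_; _≤_)
open import Data.Nat.Primality using (Prime)
open import Data.Fin using (Fin)
open import Data.Product using (Σ; ∃; _×_; _,_)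
open import Function.Bundles using (_↔_; _⇔_)
open import Relation.Binary.PropositionalEquality using (_≡_; _≢_)
open import Relation.Nullary using (¬_)

IsOddPrimePower : ℕ → Set
IsOddPrimePower q =
  Σ ℕ λ p → Σ ℕ λ k → Prime p × p ≢ 2 × 1 ≤ k × q ≡ p Data.Nat.^ k

-- A finite field with exactly q elements.  The ring's setoid equality is
-- required to coincide with propositional equality, so that all statements
-- below can use _≡_.
record FiniteField (q : ℕ) : Set₁ where
  field
    commRing : CommutativeRing 0ℓ 0ℓ
  open CommutativeRing commRing public
  field
    ≈⇔≡    : ∀ x y → (x ≈ y) ⇔ (x ≡ y)
    0≢1    : 0# ≢ 1#
    _⁻¹    : Carrier → Carrier
    inverseʳ : ∀ x → x ≢ 0# → x * (x ⁻¹) ≡ 1#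
    elements : Fin q ↔ Carrier

module FieldOps {q : ℕ} (F : FiniteField q) where
  open FiniteField F

  pow : Carrier → ℕ → Carrier
  pow x zero    = 1#
  pow x (suc n) = x * pow x n

  fromℕ : ℕ → Carrier
  fromℕ zero    = 0#
  fromℕ (suc n) = 1# + fromℕ n

  sumTo : ℕ → (ℕ → Carrier) → Carrier
  sumTo zero    g = 0#
  sumTo (suc n) g = sumTo n g + g n

  _÷_ : Carrier → Carrier → Carrier
  x ÷ y = x * (y ⁻¹)

  HasOrder : Carrier → ℕ → Set
  HasOrder u m = u ≢ 0# × 1 ≤ m × pow u m ≡ 1#
               × (∀ k → 1 ≤ k → k < m → pow u k ≢ 1#)

  IsPermutation : (Carrier → Carrier) → Set
  IsPermutation f = (∀ x y → f x ≡ f y → x ≡ y) × (∀ y → ∃ λ x → f x ≡ y)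

  iter : (Carrier → Carrier) → ℕ → Carrier → Carrier
  iter f zero    x = x
  iter f (suc n) x = f (iter f n x)

  -- cycle type 1 + m^d of a permutation f: exactly one fixed point, and the
  -- remaining points split into exactly d disjoint cycles of length m.
  -- Since the field has q = 1 + m d elements, this is expressed as: there is a
  -- unique fixed point and every other point lies on a cycle of length exactly m
  -- (the number of such cycles is then (q - 1) / m = d).
  HasCycleType1+m^d : (Carrier → Carrier) → ℕ → ℕ → Set
  HasCycleType1+m^d f m d =
    q ≡ suc (m Data.Nat.* d)
    × (∃ λ x₀ → f x₀ ≡ x₀ × (∀ y → f y ≡ y → y ≡ x₀))
    × (∀ x → f x ≢ x →
         iter f m x ≡ x × (∀ k → 1 ≤ k → k < m → iter f k x ≢ x))

  thePoly : Carrier → Carrier → ℕ → ℕ → Carrier → Carrier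
  thePoly a v m d x = a * sumTo d (λ i → pow x (i Data.Nat.* m Data.Nat.+ 1)) + v * x

-- Put y = x ^ m.  Since m d = q - 1, Fermat gives y ^ d = 1 for x ≠ 0, so the
-- geometric sum Σ_{i<d} y ^ i equals d when y = 1 and vanishes otherwise.  As
-- Σ_{i<d} x ^ (i m + 1) = (Σ_{i<d} y ^ i) x, the polynomial f multiplies the m-th
-- roots of unity by a d + v = u and every other element by v.  Both classes are
-- stable under multiplication by u and v, so f is a permutation whose iterates
-- on a nonzero x are u ^ k x or v ^ k x; u and v have order m and differ from 1,
-- hence 0 is the only fixed point and every other orbit has length m.
module Submission where

open import Defs
open import Algebra.Bundles using (CommutativeMonoid)
import Algebra.Properties.CommutativeMonoid.Sum as CommutativeMonoidSum
import Algebra.Properties.CommutativeSemiring.Exp as CommutativeSemiringExp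
import Algebra.Properties.Group as GroupProperties
import Algebra.Properties.Semiring.Exp as SemiringExp
import Algebra.Properties.Semiring.Mult as SemiringMult
open import Data.Empty using (⊥-elim)
open import Data.Fin using (Fin; zero; suc; punchIn)
import Data.Fin.Properties as Fin
open import Data.Nat using (ℕ; zero; suc; _≤_; _<_; s≤s; z≤n)
import Data.Nat as ℕ
import Data.Nat.Properties as ℕ
open import Data.Product using (_×_; _,_; ∃)
open import Function.Base using (_∘_)
open import Function.Bundles using (Inverse; Equivalence; _↔_; mk↔ₛ′)
open import Function.Construct.Composition using (_↔-∘_)
open import Function.Construct.Symmetry using (↔-sym)
open import Function.Properties.Inverse using (↔⇒↣)
open import Relation.Binary.Definitions using (DecidableEquality)
open import Relation.Binary.PropositionalEquality
  using (_≡_; _≢_; refl; sym; trans; cong; cong₂; subst; module ≡-Reasoning)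
open import Relation.Nullary using (yes; no)
open import Relation.Nullary.Decidable using (via-injection)

module _ {c ℓ} (M : CommutativeMonoid c ℓ) where
  open CommutativeMonoid M using (Carrier; _≈_; reflexive) renaming (trans to ≈-trans)
  open CommutativeMonoidSum M using (sum; sum-permute; sum-cong-≗)

  sum-reindex : ∀ {A : Set} {k} (el : Fin k ↔ A) (g : A ↔ A) (h : A → Carrier) →
                sum (h ∘ Inverse.to el) ≈ sum (h ∘ Inverse.to g ∘ Inverse.to el)
  sum-reindex {k = k} el g h =
    ≈-trans (sum-permute (h ∘ Inverse.to el) (↔-sym el ↔-∘ (g ↔-∘ el)))
            (reflexive (sum-cong-≗ {k} λ i → cong h (Inverse.strictlyInverseˡ el _)))

module FiniteFieldProperties {q : ℕ} (F : FiniteField q) where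
  private module F = FiniteField F
  open FiniteField F
    using (Carrier; 0#; 1#; _+_; _*_; _-_; _⁻¹; _≈_; 0≢1; elements; semiring;
           commutativeSemiring; +-group; +-commutativeMonoid; *-commutativeMonoid)
  open FieldOps F
  open ≡-Reasoning

  module Σ = CommutativeMonoidSum +-commutativeMonoid
  module Π = CommutativeMonoidSum *-commutativeMonoid
  open GroupProperties +-group using (∙-cancelˡ; ∙-cancelʳ; //-rightDividesˡ; //-rightDividesʳ)
  open SemiringExp semiring using (_^_; ^-homo-*; ^-assocʳ)
  open CommutativeSemiringExp commutativeSemiring using (^-distrib-*)
  open SemiringMult semiring using (×1-homo-*) renaming (_×_ to _·_)

  ≈⇒≡ : ∀ {x y} → x ≈ y → x ≡ y
  ≈⇒≡ = Equivalence.to (F.≈⇔≡ _ _)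

  ≡⇒≈ : ∀ {x y} → x ≡ y → x ≈ y
  ≡⇒≈ = Equivalence.from (F.≈⇔≡ _ _)

  +-comm : ∀ x y → x + y ≡ y + x
  +-comm x y = ≈⇒≡ (F.+-comm x y)

  +-assoc : ∀ x y z → (x + y) + z ≡ x + (y + z)
  +-assoc x y z = ≈⇒≡ (F.+-assoc x y z)

  +-identityˡ : ∀ x → 0# + x ≡ x
  +-identityˡ x = ≈⇒≡ (F.+-identityˡ x)

  +-identityʳ : ∀ x → x + 0# ≡ x
  +-identityʳ x = ≈⇒≡ (F.+-identityʳ x)

  *-comm : ∀ x y → x * y ≡ y * x
  *-comm x y = ≈⇒≡ (F.*-comm x y)

  *-assoc : ∀ x y z → (x * y) * z ≡ x * (y * z)
  *-assoc x y z = ≈⇒≡ (F.*-assoc x y z)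

  *-identityˡ : ∀ x → 1# * x ≡ x
  *-identityˡ x = ≈⇒≡ (F.*-identityˡ x)

  *-identityʳ : ∀ x → x * 1# ≡ x
  *-identityʳ x = ≈⇒≡ (F.*-identityʳ x)

  zeroˡ : ∀ x → 0# * x ≡ 0#
  zeroˡ x = ≈⇒≡ (F.zeroˡ x)

  zeroʳ : ∀ x → x * 0# ≡ 0#
  zeroʳ x = ≈⇒≡ (F.zeroʳ x)

  distribˡ : ∀ x y z → x * (y + z) ≡ x * y + x * z
  distribˡ x y z = ≈⇒≡ (F.distribˡ x y z)

  distribʳ : ∀ x y z → (y + z) * x ≡ y * x + z * x
  distribʳ x y z = ≈⇒≡ (F.distribʳ x y z)

  +-cancelˡ : ∀ x {y z} → x + y ≡ x + z → y ≡ z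
  +-cancelˡ x e = ≈⇒≡ (∙-cancelˡ x _ _ (≡⇒≈ e))

  +-cancelʳ : ∀ x {y z} → y + x ≡ z + x → y ≡ z
  +-cancelʳ x e = ≈⇒≡ (∙-cancelʳ x _ _ (≡⇒≈ e))

  _≟_ : DecidableEquality Carrier
  _≟_ = via-injection (↔⇒↣ (↔-sym elements)) Fin._≟_

  1#≢0# : 1# ≢ 0#
  1#≢0# = 0≢1 ∘ sym

  inverseˡ : ∀ x → x ≢ 0# → x ⁻¹ * x ≡ 1#
  inverseˡ x x≢0 = trans (*-comm _ x) (F.inverseʳ x x≢0)

  *-⁻¹-cancelˡ : ∀ s → s ≢ 0# → ∀ y → s * (s ⁻¹ * y) ≡ y
  *-⁻¹-cancelˡ s s≢0 y = trans (sym (*-assoc s _ y)) (trans (cong (_* y) (F.inverseʳ s s≢0)) (*-identityˡ y))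

  ⁻¹-*-cancelˡ : ∀ s → s ≢ 0# → ∀ y → s ⁻¹ * (s * y) ≡ y
  ⁻¹-*-cancelˡ s s≢0 y = trans (sym (*-assoc _ s y)) (trans (cong (_* y) (inverseˡ s s≢0)) (*-identityˡ y))

  *-cancelʳ : ∀ c {x y} → c ≢ 0# → x * c ≡ y * c → x ≡ y
  *-cancelʳ c {x} {y} c≢0 e = begin
    x                ≡⟨ sym (*-identityʳ x) ⟩
    x * 1#           ≡⟨ cong (x *_) (sym (F.inverseʳ c c≢0)) ⟩
    x * (c * c ⁻¹)   ≡⟨ sym (*-assoc x c _) ⟩
    (x * c) * c ⁻¹   ≡⟨ cong (_* c ⁻¹) e ⟩
    (y * c) * c ⁻¹   ≡⟨ *-assoc y c _ ⟩
    y * (c * c ⁻¹)   ≡⟨ cong (y *_) (F.inverseʳ c c≢0) ⟩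
    y * 1#           ≡⟨ *-identityʳ y ⟩
    y                ∎

  *-cancelˡ : ∀ c {x y} → c ≢ 0# → c * x ≡ c * y → x ≡ y
  *-cancelˡ c {x} {y} c≢0 e = *-cancelʳ c c≢0 (trans (*-comm x c) (trans e (*-comm c y)))

  *-preserves-≢0# : ∀ {x y} → x ≢ 0# → y ≢ 0# → x * y ≢ 0#
  *-preserves-≢0# {x} {y} x≢0 y≢0 xy≡0 =
    y≢0 (*-cancelˡ x x≢0 (trans xy≡0 (sym (zeroʳ x))))

  pow≡^ : ∀ x n → pow x n ≡ x ^ n
  pow≡^ x zero    = refl
  pow≡^ x (suc n) = cong (x *_) (pow≡^ x n)

  fromℕ≡·1# : ∀ n → fromℕ n ≡ n · 1#
  fromℕ≡·1# zero    = refl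
  fromℕ≡·1# (suc n) = cong (1# +_) (fromℕ≡·1# n)

  pow-homo-+ : ∀ x a b → pow x (a ℕ.+ b) ≡ pow x a * pow x b
  pow-homo-+ x a b rewrite pow≡^ x (a ℕ.+ b) | pow≡^ x a | pow≡^ x b = ≈⇒≡ (^-homo-* x a b)

  pow-assocʳ : ∀ x a b → pow (pow x a) b ≡ pow x (a ℕ.* b)
  pow-assocʳ x a b rewrite pow≡^ (pow x a) b | pow≡^ x a | pow≡^ x (a ℕ.* b) = ≈⇒≡ (^-assocʳ x a b)

  pow-distrib-* : ∀ x y n → pow (x * y) n ≡ pow x n * pow y n
  pow-distrib-* x y n rewrite pow≡^ (x * y) n | pow≡^ x n | pow≡^ y n = ≈⇒≡ (^-distrib-* x y n)

  pow-zeroˡ : ∀ n → pow 1# n ≡ 1#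
  pow-zeroˡ zero    = refl
  pow-zeroˡ (suc n) = trans (*-identityˡ _) (pow-zeroˡ n)

  fromℕ-homo-* : ∀ a b → fromℕ (a ℕ.* b) ≡ fromℕ a * fromℕ b
  fromℕ-homo-* a b rewrite fromℕ≡·1# (a ℕ.* b) | fromℕ≡·1# a | fromℕ≡·1# b = ≈⇒≡ (×1-homo-* a b)

  sumTo-cong : ∀ n {g h : ℕ → Carrier} → (∀ i → g i ≡ h i) → sumTo n g ≡ sumTo n h
  sumTo-cong zero    e = refl
  sumTo-cong (suc n) e = cong₂ _+_ (sumTo-cong n e) (e n)

  sumTo-distribʳ : ∀ n g c → sumTo n g * c ≡ sumTo n (λ i → g i * c)
  sumTo-distribʳ zero    g c = zeroˡ c
  sumTo-distribʳ (suc n) g c = trans (distribʳ c _ _) (cong (_+ g n * c) (sumTo-distribʳ n g c))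

  sumTo-1# : ∀ n → sumTo n (λ _ → 1#) ≡ fromℕ n
  sumTo-1# zero    = refl
  sumTo-1# (suc n) = trans (cong (_+ 1#) (sumTo-1# n)) (+-comm _ 1#)

  geometric-sum : ∀ y n → y * sumTo n (pow y) + 1# ≡ sumTo n (pow y) + pow y n
  geometric-sum y zero    = cong (_+ 1#) (zeroʳ y)
  geometric-sum y (suc n) = begin
    y * (G + pow y n) + 1#          ≡⟨ cong (_+ 1#) (distribˡ y G _) ⟩
    (y * G + pow y (suc n)) + 1#    ≡⟨ +-assoc _ _ _ ⟩
    y * G + (pow y (suc n) + 1#)    ≡⟨ cong (y * G +_) (+-comm _ 1#) ⟩
    y * G + (1# + pow y (suc n))    ≡⟨ sym (+-assoc _ _ _) ⟩
    (y * G + 1#) + pow y (suc n)    ≡⟨ cong (_+ pow y (suc n)) (geometric-sum y n) ⟩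
    (G + pow y n) + pow y (suc n)   ∎
    where G = sumTo n (pow y)

  geometric-sum≡0# : ∀ y n → pow y n ≡ 1# → y ≢ 1# → sumTo n (pow y) ≡ 0#
  geometric-sum≡0# y n yⁿ≡1 y≢1 with sumTo n (pow y) ≟ 0#
  ... | yes G≡0 = G≡0
  ... | no  G≢0 = ⊥-elim (y≢1 (*-cancelʳ G G≢0 (trans yG≡G (sym (*-identityˡ G)))))
    where
    G = sumTo n (pow y)
    yG≡G : y * G ≡ G
    yG≡G = +-cancelʳ 1# (trans (geometric-sum y n) (cong (G +_) yⁿ≡1))

  Σ-1# : ∀ k → Σ.sum {k} (λ _ → 1#) ≡ fromℕ k
  Σ-1# zero    = refl
  Σ-1# (suc k) = cong (1# +_) (Σ-1# k)

  -- Translation by 1# permutes the field, so Σ x = Σ (x + 1) = Σ x + q.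
  fromℕ-size≡0# : fromℕ q ≡ 0#
  fromℕ-size≡0# = +-cancelˡ S (sym (begin
    S + 0#                        ≡⟨ +-identityʳ S ⟩
    S                             ≡⟨ ≈⇒≡ (sum-reindex +-commutativeMonoid elements translate (λ x → x)) ⟩
    Σ.sum (λ i → to i + 1#)       ≡⟨ ≈⇒≡ (Σ.∑-distrib-+ to (λ _ → 1#)) ⟩
    S + Σ.sum {q} (λ _ → 1#)      ≡⟨ cong (S +_) (Σ-1# q) ⟩
    S + fromℕ q                   ∎))
    where
    to = Inverse.to elements
    S = Σ.sum to
    translate : Carrier ↔ Carrier
    translate = mk↔ₛ′ (_+ 1#) (_- 1#) (λ y → ≈⇒≡ (//-rightDividesˡ 1# y))
                                      (λ y → ≈⇒≡ (//-rightDividesʳ 1# y))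

  ifZero_then_else_ : Carrier → Carrier → Carrier → Carrier
  ifZero x then b else c with x ≟ 0#
  ... | yes _ = b
  ... | no  _ = c

  ifZero-≡0# : ∀ {x} b c → x ≡ 0# → ifZero x then b else c ≡ b
  ifZero-≡0# {x} b c x≡0 with x ≟ 0#
  ... | yes _   = refl
  ... | no  x≢0 = ⊥-elim (x≢0 x≡0)

  ifZero-≢0# : ∀ {x} b c → x ≢ 0# → ifZero x then b else c ≡ c
  ifZero-≢0# {x} b c x≢0 with x ≟ 0#
  ... | yes x≡0 = ⊥-elim (x≢0 x≡0)
  ... | no  _   = refl

  nonzeroPart : Carrier → Carrier
  nonzeroPart x = ifZero x then 1# else x

  nonzeroPart-≢0# : ∀ x → nonzeroPart x ≢ 0#
  nonzeroPart-≢0# x with x ≟ 0#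
  ... | yes _   = 1#≢0#
  ... | no  x≢0 = x≢0

  nonzeroPart-* : ∀ a → a ≢ 0# → ∀ x →
                  nonzeroPart (a * x) ≡ (ifZero x then 1# else a) * nonzeroPart x
  nonzeroPart-* a a≢0 x with x ≟ 0#
  ... | yes x≡0 = begin
    nonzeroPart (a * x)  ≡⟨ ifZero-≡0# 1# _ (trans (cong (a *_) x≡0) (zeroʳ a)) ⟩
    1#                   ≡⟨ sym (*-identityʳ 1#) ⟩
    1# * 1#              ∎
  ... | no  x≢0 = ifZero-≢0# 1# _ (*-preserves-≢0# a≢0 x≢0)

  Π-≢0# : ∀ {k} (g : Fin k → Carrier) → (∀ i → g i ≢ 0#) → Π.sum g ≢ 0#
  Π-≢0# {zero}  g g≢0 = 1#≢0#
  Π-≢0# {suc k} g g≢0 = *-preserves-≢0# (g≢0 zero) (Π-≢0# (g ∘ suc) (g≢0 ∘ suc))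

  Π-const : ∀ {k} a (g : Fin k → Carrier) → (∀ i → g i ≡ a) → Π.sum g ≡ pow a k
  Π-const {k} a g g≡a =
    trans (Π.sum-cong-≗ g≡a) (trans (≈⇒≡ (Π.sum-replicate k)) (sym (pow≡^ a k)))

  -- Multiplication by a permutes the field, so Π n(x) = Π n(a x) = a ^ (q - 1) Π n(x)
  -- for n = nonzeroPart, whose product is nonzero.
  fermat : ∀ {k} → q ≡ suc k → ∀ a → a ≢ 0# → pow a k ≡ 1#
  fermat {k} q≡1+k a a≢0 = begin
    pow a k                          ≡⟨ sym (*-identityˡ _) ⟩
    1# * pow a k                     ≡⟨ cong₂ _*_ (sym (ifZero-≡0# 1# a (Inverse.strictlyInverseˡ el 0#)))
                                                  (sym (Π-const a _ punched≢0)) ⟩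
    c z * Π.sum (c ∘ punchIn z)      ≡⟨ ≈⇒≡ (F.sym (Π.sum-remove {i = z} c)) ⟩
    C                                ≡⟨ *-cancelʳ P (Π-≢0# _ (nonzeroPart-≢0# ∘ to)) (sym CP≡P) ⟩
    1#                               ∎
    where
    el : Fin (suc k) ↔ Carrier
    el = subst (λ n → Fin n ↔ Carrier) q≡1+k elements
    to = Inverse.to el
    z = Inverse.from el 0#
    c : Fin (suc k) → Carrier
    c i = ifZero to i then 1# else a
    C = Π.sum c
    P = Π.sum (nonzeroPart ∘ to)
    punched≢0 : ∀ j → c (punchIn z j) ≡ a
    punched≢0 j = ifZero-≢0# 1# a λ e →
      Fin.punchInᵢ≢i z j (trans (sym (Inverse.strictlyInverseʳ el _)) (cong (Inverse.from el) e))
    scale : Carrier ↔ Carrier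
    scale = mk↔ₛ′ (a *_) (a ⁻¹ *_) (*-⁻¹-cancelˡ a a≢0) (⁻¹-*-cancelˡ a a≢0)
    CP≡P : 1# * P ≡ C * P
    CP≡P = begin
      1# * P                                 ≡⟨ *-identityˡ P ⟩
      P                                      ≡⟨ ≈⇒≡ (sum-reindex *-commutativeMonoid el scale nonzeroPart) ⟩
      Π.sum (λ i → nonzeroPart (a * to i))   ≡⟨ Π.sum-cong-≗ (nonzeroPart-* a a≢0 ∘ to) ⟩
      Π.sum (λ i → c i * nonzeroPart (to i)) ≡⟨ ≈⇒≡ (Π.∑-distrib-+ c (nonzeroPart ∘ to)) ⟩
      C * P                                  ∎

  hasOrder-1#⇒≡1 : ∀ {m} → HasOrder 1# m → m ≡ 1
  hasOrder-1#⇒≡1 {suc zero}    _                   = refl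
  hasOrder-1#⇒≡1 {suc (suc m)} (_ , _ , _ , minimal) =
    ⊥-elim (minimal 1 (s≤s z≤n) (s≤s (s≤s z≤n)) (*-identityʳ 1#))

  distinct-of-same-order⇒≢1# : ∀ {u v m} → HasOrder u m → HasOrder v m → u ≢ v → u ≢ 1#
  distinct-of-same-order⇒≢1# {u} {v} {m} hu (_ , _ , vᵐ≡1 , _) u≢v refl = u≢v (sym (begin
    v          ≡⟨ sym (*-identityʳ v) ⟩
    pow v 1    ≡⟨ cong (pow v) (sym (hasOrder-1#⇒≡1 hu)) ⟩
    pow v m    ≡⟨ vᵐ≡1 ⟩
    1#         ∎))

  thePoly-factor : ∀ a v m d x →
                   thePoly a v m d x ≡ a * (sumTo d (pow (pow x m)) * x) + v * x
  thePoly-factor a v m d x =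
    cong (λ t → a * t + v * x) (trans (sumTo-cong d term) (sym (sumTo-distribʳ d _ x)))
    where
    term : ∀ i → pow x (i ℕ.* m ℕ.+ 1) ≡ pow (pow x m) i * x
    term i = begin
      pow x (i ℕ.* m ℕ.+ 1)       ≡⟨ pow-homo-+ x (i ℕ.* m) 1 ⟩
      pow x (i ℕ.* m) * pow x 1   ≡⟨ cong₂ _*_ (cong (pow x) (ℕ.*-comm i m)) (*-identityʳ x) ⟩
      pow x (m ℕ.* i) * x         ≡⟨ cong (_* x) (sym (pow-assocʳ x m i)) ⟩
      pow (pow x m) i * x         ∎

  module _ (m : ℕ) where

    pow-root-* : ∀ {s} → pow s m ≡ 1# → ∀ x → pow (s * x) m ≡ pow x m
    pow-root-* sᵐ≡1 x = trans (pow-distrib-* _ x m) (trans (cong (_* pow x m) sᵐ≡1) (*-identityˡ _))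

    pow-root-pow : ∀ {s} → pow s m ≡ 1# → ∀ k → pow (pow s k) m ≡ 1#
    pow-root-pow {s} sᵐ≡1 k = begin
      pow (pow s k) m   ≡⟨ pow-assocʳ s k m ⟩
      pow s (k ℕ.* m)   ≡⟨ cong (pow s) (ℕ.*-comm k m) ⟩
      pow s (m ℕ.* k)   ≡⟨ sym (pow-assocʳ s m k) ⟩
      pow (pow s m) k   ≡⟨ cong (λ t → pow t k) sᵐ≡1 ⟩
      pow 1# k          ≡⟨ pow-zeroˡ k ⟩
      1#                ∎

    pow-root-⁻¹ : ∀ {s} → s ≢ 0# → pow s m ≡ 1# → pow (s ⁻¹) m ≡ 1#
    pow-root-⁻¹ {s} s≢0 sᵐ≡1 = begin
      pow (s ⁻¹) m            ≡⟨ sym (pow-root-* sᵐ≡1 _) ⟩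
      pow (s * s ⁻¹) m        ≡⟨ cong (λ t → pow t m) (F.inverseʳ s s≢0) ⟩
      pow 1# m                ≡⟨ pow-zeroˡ m ⟩
      1#                      ∎

    iter-root-scaling : ∀ (P : Carrier → Set) (f : Carrier → Carrier) {s} → pow s m ≡ 1# →
                        (∀ y → P (pow y m) → f y ≡ s * y) →
                        ∀ k {x} → P (pow x m) → iter f k x ≡ pow s k * x
    iter-root-scaling P f     sᵐ≡1 scales zero    {x} _  = sym (*-identityˡ x)
    iter-root-scaling P f {s} sᵐ≡1 scales (suc k) {x} Px = begin
      f (iter f k x)     ≡⟨ cong f (iter-root-scaling P f sᵐ≡1 scales k Px) ⟩
      f (pow s k * x)    ≡⟨ scales _ (subst P (sym (pow-root-* (pow-root-pow sᵐ≡1 k) x)) Px) ⟩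
      s * (pow s k * x)  ≡⟨ sym (*-assoc s _ x) ⟩
      pow s (suc k) * x  ∎

    orbit-of-scaling : ∀ (f : Carrier → Carrier) {s x} → HasOrder s m → x ≢ 0# →
                       (∀ k → iter f k x ≡ pow s k * x) →
                       iter f m x ≡ x × (∀ k → 1 ≤ k → k < m → iter f k x ≢ x)
    orbit-of-scaling f {s} {x} (_ , _ , sᵐ≡1 , minimal) x≢0 iterates =
      trans (iterates m) (trans (cong (_* x) sᵐ≡1) (*-identityˡ x)) ,
      λ k 1≤k k<m fᵏx≡x → minimal k 1≤k k<m
        (*-cancelʳ x x≢0 (trans (sym (iterates k)) (trans fᵏx≡x (sym (*-identityˡ x)))))

  module PermutationPolynomial (m d : ℕ) (q≡1+md : q ≡ suc (m ℕ.* d)) (u v : Carrier)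
                               (u≢v : u ≢ v) (hu : HasOrder u m) (hv : HasOrder v m) where

    a : Carrier
    a = (u - v) ÷ fromℕ d

    f : Carrier → Carrier
    f = thePoly a v m d

    uᵐ≡1 : pow u m ≡ 1#
    uᵐ≡1 = let (_ , _ , e , _) = hu in e

    vᵐ≡1 : pow v m ≡ 1#
    vᵐ≡1 = let (_ , _ , e , _) = hv in e

    u≢0 : u ≢ 0#
    u≢0 = let (n , _) = hu in n

    v≢0 : v ≢ 0#
    v≢0 = let (n , _) = hv in n

    fromℕd≢0# : fromℕ d ≢ 0#
    fromℕd≢0# d≡0 = 1#≢0# (begin
      1#                         ≡⟨ sym (+-identityʳ 1#) ⟩
      1# + 0#                    ≡⟨ cong (1# +_) (sym (trans (cong (fromℕ m *_) d≡0) (zeroʳ _))) ⟩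
      1# + fromℕ m * fromℕ d     ≡⟨ cong (1# +_) (sym (fromℕ-homo-* m d)) ⟩
      fromℕ (suc (m ℕ.* d))      ≡⟨ cong fromℕ (sym q≡1+md) ⟩
      fromℕ q                    ≡⟨ fromℕ-size≡0# ⟩
      0#                         ∎)

    f-root : ∀ x → pow x m ≡ 1# → f x ≡ u * x
    f-root x xᵐ≡1 = begin
      f x                                    ≡⟨ thePoly-factor a v m d x ⟩
      a * (sumTo d (pow (pow x m)) * x) + v * x
        ≡⟨ cong (λ t → a * (t * x) + v * x) (trans (sumTo-cong d λ i → trans (cong (λ t → pow t i) xᵐ≡1)
                                                                              (pow-zeroˡ i))
                                                   (sumTo-1# d)) ⟩
      a * (fromℕ d * x) + v * x              ≡⟨ cong (_+ v * x) (sym (*-assoc a _ x)) ⟩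
      (a * fromℕ d) * x + v * x              ≡⟨ cong (λ t → t * x + v * x) ad≡u-v ⟩
      (u - v) * x + v * x                    ≡⟨ sym (distribʳ x _ v) ⟩
      ((u - v) + v) * x                      ≡⟨ cong (_* x) (≈⇒≡ (//-rightDividesˡ v u)) ⟩
      u * x                                  ∎
      where
      ad≡u-v : a * fromℕ d ≡ u - v
      ad≡u-v = trans (*-assoc _ _ _) (trans (cong ((u - v) *_) (inverseˡ _ fromℕd≢0#)) (*-identityʳ _))

    nonroot-sum≡0# : ∀ x → pow x m ≢ 1# → sumTo d (pow (pow x m)) * x ≡ 0#
    nonroot-sum≡0# x xᵐ≢1 with x ≟ 0#
    ... | yes x≡0 = trans (cong (sumTo d (pow (pow x m)) *_) x≡0) (zeroʳ _)
    ... | no  x≢0 = trans (cong (_* x) (geometric-sum≡0# (pow x m) d yᵈ≡1 xᵐ≢1)) (zeroˡ x)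
      where
      yᵈ≡1 : pow (pow x m) d ≡ 1#
      yᵈ≡1 = trans (pow-assocʳ x m d) (fermat q≡1+md x x≢0)

    f-nonroot : ∀ x → pow x m ≢ 1# → f x ≡ v * x
    f-nonroot x xᵐ≢1 = begin
      f x                                         ≡⟨ thePoly-factor a v m d x ⟩
      a * (sumTo d (pow (pow x m)) * x) + v * x   ≡⟨ cong (λ t → a * t + v * x) (nonroot-sum≡0# x xᵐ≢1) ⟩
      a * 0# + v * x                              ≡⟨ cong (_+ v * x) (zeroʳ a) ⟩
      0# + v * x                                  ≡⟨ +-identityˡ _ ⟩
      v * x                                       ∎

    f-injective : ∀ x y → f x ≡ f y → x ≡ y
    f-injective x y fx≡fy with pow x m ≟ 1# | pow y m ≟ 1#
    ... | yes xᵐ≡1 | yes yᵐ≡1 =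
      *-cancelˡ u u≢0 (trans (sym (f-root x xᵐ≡1)) (trans fx≡fy (f-root y yᵐ≡1)))
    ... | no  xᵐ≢1 | no  yᵐ≢1 =
      *-cancelˡ v v≢0 (trans (sym (f-nonroot x xᵐ≢1)) (trans fx≡fy (f-nonroot y yᵐ≢1)))
    ... | yes xᵐ≡1 | no  yᵐ≢1 = ⊥-elim (yᵐ≢1 (begin
      pow y m          ≡⟨ sym (pow-root-* m vᵐ≡1 y) ⟩
      pow (v * y) m    ≡⟨ cong (λ t → pow t m) (trans (sym (f-nonroot y yᵐ≢1)) (trans (sym fx≡fy) (f-root x xᵐ≡1))) ⟩
      pow (u * x) m    ≡⟨ pow-root-* m uᵐ≡1 x ⟩
      pow x m          ≡⟨ xᵐ≡1 ⟩
      1#               ∎))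
    ... | no  xᵐ≢1 | yes yᵐ≡1 = ⊥-elim (xᵐ≢1 (begin
      pow x m          ≡⟨ sym (pow-root-* m vᵐ≡1 x) ⟩
      pow (v * x) m    ≡⟨ cong (λ t → pow t m) (trans (sym (f-nonroot x xᵐ≢1)) (trans fx≡fy (f-root y yᵐ≡1))) ⟩
      pow (u * y) m    ≡⟨ pow-root-* m uᵐ≡1 y ⟩
      pow y m          ≡⟨ yᵐ≡1 ⟩
      1#               ∎))

    f-surjective : ∀ y → ∃ λ x → f x ≡ y
    f-surjective y with pow y m ≟ 1#
    ... | yes yᵐ≡1 = u ⁻¹ * y , trans (f-root _ xᵐ≡1) (*-⁻¹-cancelˡ u u≢0 y)
      where xᵐ≡1 = trans (pow-root-* m (pow-root-⁻¹ m u≢0 uᵐ≡1) y) yᵐ≡1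
    ... | no  yᵐ≢1 = v ⁻¹ * y , trans (f-nonroot _ xᵐ≢1) (*-⁻¹-cancelˡ v v≢0 y)
      where xᵐ≢1 = yᵐ≢1 ∘ trans (sym (pow-root-* m (pow-root-⁻¹ m v≢0 vᵐ≡1) y))

    f-0# : f 0# ≡ 0#
    f-0# = trans (thePoly-factor a v m d 0#)
                 (trans (cong₂ (λ s t → a * s + t) (zeroʳ _) (zeroʳ v))
                        (trans (cong (_+ 0#) (zeroʳ a)) (+-identityʳ 0#)))

    fixed⇒≡0# : ∀ y → f y ≡ y → y ≡ 0#
    fixed⇒≡0# y fy≡y with y ≟ 0# | pow y m ≟ 1#
    ... | yes y≡0 | _ = y≡0
    ... | no  y≢0 | yes yᵐ≡1 = ⊥-elim (distinct-of-same-order⇒≢1# hu hv u≢v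
      (*-cancelʳ y y≢0 (trans (sym (f-root y yᵐ≡1)) (trans fy≡y (sym (*-identityˡ y))))))
    ... | no  y≢0 | no  yᵐ≢1 = ⊥-elim (distinct-of-same-order⇒≢1# hv hu (u≢v ∘ sym)
      (*-cancelʳ y y≢0 (trans (sym (f-nonroot y yᵐ≢1)) (trans fy≡y (sym (*-identityˡ y))))))

    moved⇒≢0# : ∀ x → f x ≢ x → x ≢ 0#
    moved⇒≢0# x fx≢x x≡0 = fx≢x (trans (cong f x≡0) (trans f-0# (sym x≡0)))

    f-orbits : ∀ x → f x ≢ x → iter f m x ≡ x × (∀ k → 1 ≤ k → k < m → iter f k x ≢ x)
    f-orbits x fx≢x with pow x m ≟ 1#
    ... | yes xᵐ≡1 = orbit-of-scaling m f hu (moved⇒≢0# x fx≢x)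
                       (λ k → iter-root-scaling m (_≡ 1#) f uᵐ≡1 f-root k xᵐ≡1)
    ... | no  xᵐ≢1 = orbit-of-scaling m f hv (moved⇒≢0# x fx≢x)
                       (λ k → iter-root-scaling m (_≢ 1#) f vᵐ≡1 f-nonroot k xᵐ≢1)

open Data.Nat using (_*_)

mainTheorem7 : (q : ℕ) → IsOddPrimePower q → (F : FiniteField q) →
    (m d : ℕ) → 1 ≤ m → 1 ≤ d → q ≡ suc (m * d) →
    (u v : FiniteField.Carrier F) → u ≢ v →
    FieldOps.HasOrder F u m → FieldOps.HasOrder F v m →
    let a = FieldOps._÷_ F (FiniteField._-_ F u v) (FieldOps.fromℕ F d)
        f = FieldOps.thePoly F a v m d
    in FieldOps.IsPermutation F f × FieldOps.HasCycleType1+m^d F f m d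
mainTheorem7 q _ F m d _ _ q≡1+md u v u≢v hu hv =
  (f-injective , f-surjective) , q≡1+md , (0# , f-0# , fixed⇒≡0#) , f-orbits
  where
  open FiniteField F using (0#)
  open FiniteFieldProperties.PermutationPolynomial F m d q≡1+md u v u≢v hu hv
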